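{- Let $q>2$ be a prime power and $d\ge2$ an integer, and let $\mu$ be a positive integer. Then the pair $(Sp(2d,q),\mu)$ is feasible if and only if $q(q^{d-1}-1)\equiv 6\pmod 8$, $\mu=(q^d-q+2)/8$, and there is an integer $x$ with $$\Big(\frac{q^d-1}{q-1}\Big)^2-q^d\Big(\frac{q^{d-1}-1}{q-1}\Big)=x^2.$$
   Context: Let $V$ be a $2d$-dimensional vector space over the field of order $q$ with a non-degenerate symplectic (alternating) bilinear form $\langle\cdot,\cdot\rangle$. The symplectic graph $Sp(2d,q)$ has as vertices the points (1-dimensional subspaces $[x]$) of the projective space $PG(2d-1,q)$, with $[x],[y]$ adjacent iff $\langle x,y\rangle\ne0$. For a connected non-complete strongly regular graph $G$ with eigenvalues $a>\rho>\sigma$ of multiplicities $1,f,g$ and a positive integer $\mu$: set $v=f+1$, $b=f+g+1$, and for each root $\lambda$ of $x^2-(f+g+1-2(\rho-\sigma)\mu)x+(\rho-\sigma)\mu((\rho-\sigma)\mu-\frac{f+g+1}{f+1})=0$ set $r=\lambda+(\rho-\sigma)\mu$, $\lambda_1=\frac{(f+1)(\lambda+\rho\mu)+g\sigma\mu}{f+g+1}$, $\lambda_2=\lambda_1+\mu$, $k=\lambda_1-\sigma\mu$. $(G,\mu)$ is called feasible (parametric feasibility of a quasi-symmetric 2-design with block graph $G$ and defect $\mu$) if for both roots all of these are non-negative integers satisfying $bk=rv$, $r(k-1)=\lambda(v-1)$. -}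

module Defs where

open import Data.Nat as ℕ using (ℕ; zero; suc; _^_; _∸_)
open import Data.Integer as ℤ using (ℤ; +_)
open import Data.Rational as Q using (ℚ; _/_)
open import Data.Product using (Σ; ∃; _×_)
open import Relation.Binary.PropositionalEquality using (_≡_)

⟦_⟧ℤ : ℤ → ℚ
⟦ z ⟧ℤ = z / 1

⟦_⟧ℕ : ℕ → ℚ
⟦ n ⟧ℕ = (+ n) / 1

IsNatℚ : ℚ → Set
IsNatℚ x = ∃ λ (n : ℕ) → x ≡ ⟦ n ⟧ℕ

-- geometric sum  1 + q + ... + q^(n-1)  (= (q^n - 1)/(q - 1) for q ≥ 2)
gsum : ℕ → ℕ → ℕ
gsum q zero    = 0
gsum q (suc n) = gsum q n ℕ.+ q ^ n

-- Parametric feasibility (quasi-symmetric 2-design with block graph G,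
-- defect μ), in terms of the non-principal eigenvalues ρ > σ of G and
-- their multiplicities f, g.

module Feas (ρ σ : ℤ) (f g μ : ℕ) where
  open Q using (_+_; _*_; _-_)

  Dμ : ℚ
  Dμ = ⟦ (ρ ℤ.- σ) ℤ.* (+ μ) ⟧ℤ

  vℚ bℚ : ℚ
  vℚ = ⟦ suc f ⟧ℕ
  bℚ = ⟦ suc (f ℕ.+ g) ⟧ℕ

  B C : ℚ
  B = bℚ - ⟦ + 2 ⟧ℤ * Dμ
  C = Dμ * (Dμ - ((+ suc (f ℕ.+ g)) / suc f))

  IsRoot : ℚ → Set
  IsRoot l = (l * l - B * l) + C ≡ Q.0ℚ

  r λ₁ λ₂ k : ℚ → ℚ
  r l  = l + Dμ
  λ₁ l = (vℚ * (l + ⟦ ρ ℤ.* (+ μ) ⟧ℤ) + ⟦ (+ g) ℤ.* σ ℤ.* (+ μ) ⟧ℤ)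
           * ((+ 1) / suc (f ℕ.+ g))
  λ₂ l = λ₁ l + ⟦ μ ⟧ℕ
  k l  = λ₁ l - ⟦ σ ℤ.* (+ μ) ⟧ℤ

  Good : ℚ → Set
  Good l = IsNatℚ l × IsNatℚ (r l) × IsNatℚ (λ₁ l) × IsNatℚ (λ₂ l)
         × IsNatℚ (k l)
         × (bℚ * k l ≡ r l * vℚ)
         × (r l * (k l - Q.1ℚ) ≡ l * (vℚ - Q.1ℚ))

  -- both roots (over ℂ) satisfy the conditions.  Since all conditions
  -- force the roots to be rational, this is: the quadratic has a rational
  -- root (hence both roots are rational) and every rational root is Good.
  Feasible : Set
  Feasible = (∃ λ (l : ℚ) → IsRoot l) × (∀ (l : ℚ) → IsRoot l → Good l)

-- feasibility of (G, μ) for an SRG with spectrum a^1, ρ^f, σ^g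
-- (a is not used by the definition)
FeasibleSRG : (ρ σ : ℤ) (f g μ : ℕ) → Set
FeasibleSRG ρ σ f g μ = Feas.Feasible ρ σ f g μ

-- Spectrum of the symplectic graph Sp(2d,q):
-- v = (q^(2d)-1)/(q-1) vertices, degree a = q^(2d-1),
-- eigenvalues ρ = q^(d-1), σ = -q^(d-1) with multiplicities
-- f = (v - 1 - q^d)/2, g = (v - 1 + q^d)/2.

module SpSpectrum (d q : ℕ) where
  nV : ℕ
  nV = gsum q (2 ℕ.* d)
  ρ σ : ℤ
  ρ = + (q ^ (d ∸ 1))
  σ = ℤ.- (+ (q ^ (d ∸ 1)))
  f g : ℕ
  f = ((nV ∸ 1) ∸ q ^ d) ℕ./ 2
  g = ((nV ∸ 1) ℕ.+ q ^ d) ℕ./ 2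

FeasibleSp : (d q μ : ℕ) → Set
FeasibleSp d q μ = FeasibleSRG ρ σ f g μ
  where open SpSpectrum d q

IsPrimePower : ℕ → Set
IsPrimePower q = ∃ λ p → ∃ λ n → Prime' p × q ≡ p ^ suc n
  where open import Data.Nat.Primality renaming (Prime to Prime')

-- Both sides fail for q > 2. Write Q = q^d = p^K, G = (q^d - 1)/(q - 1), H = (q^(d-1) - 1)/(q - 1), so
-- G = 1 + qH and 2G < Q. Feasibility gives two integral roots, hence integers w₁, w₂ = 2r/(Q + 1) with
-- w₁ + w₂ = 2G and v w₁ w₂ = 4QμGH, where v = f + 1 is prime to p. The square condition gives
-- (G - y)(G + y) = QH with factors summing to 2G, while for p = 2 the congruence fails since 4 ∣ q.
-- In the remaining cases p does not divide the sum of the two factors (after halving both when p = 2),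
-- so Q divides one factor, forcing Q ≤ 2G.
module Submission where

open import Defs
open import Data.Nat
open import Data.Nat.Properties
open import Data.Nat.Divisibility
open import Data.Nat.DivMod using (_/_; _%_; m*n/n≡m)
open import Data.Nat.Primality using (Prime; prime[2]; euclidsLemma; irreducible[2]; ¬prime[1]; prime⇒nonZero)
open import Data.Nat.Tactic.RingSolver using (solve)
open import Data.Integer as ℤ using (ℤ; +_)
open import Data.Integer.Properties as ℤ using (pos-*; neg-involutive)
open import Data.Rational as ℚ using (1ℚ; toℚᵘ)
open import Data.Rational.Properties using (toℚᵘ-fromℚᵘ; toℚᵘ-homo-+; toℚᵘ-homo-*; toℚᵘ-injective; toℚᵘ-cong)
open import Data.Rational.Solver using (module +-*-Solver)
open import Data.Rational.Unnormalised as ℚᵘ using (mkℚᵘ; *≡*)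
open import Data.Rational.Unnormalised.Properties as ℚᵘ using ()
open import Data.List using (_∷_; [])
open import Data.Product using (∃; Σ-syntax; _×_; _,_; proj₁; proj₂)
open import Data.Empty using (⊥; ⊥-elim)
open import Data.Sum using (inj₁; inj₂)
open import Function using (_∘_)
open import Function.Bundles using (_⇔_; mk⇔)
open import Relation.Nullary using (¬_; yes; no; contradiction)
open import Relation.Nullary.Decidable using (toWitnessFalse)
open import Relation.Binary.PropositionalEquality

m*n>0⇒m>0 : ∀ m {n} → 0 < m * n → 0 < m
m*n>0⇒m>0 (suc _) _ = z<s

prime⇒∤1 : ∀ {p} → Prime p → p ∤ 1
prime⇒∤1 p-prime p∣1 = ¬prime[1] (subst Prime (∣1⇒≡1 p∣1) p-prime)

prime∣2⇒≡2 : ∀ {p} → Prime p → p ∣ 2 → p ≡ 2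
prime∣2⇒≡2 p-prime p∣2 with irreducible[2] p∣2
... | inj₁ p≡1 = contradiction (subst Prime p≡1 p-prime) ¬prime[1]
... | inj₂ p≡2 = p≡2

prime∣m⇒∤1+m*n : ∀ {p m} n → Prime p → p ∣ m → p ∤ suc (m * n)
prime∣m⇒∤1+m*n {p} {m} n p-prime p∣m p∣1+mn =
  prime⇒∤1 p-prime (∣m+n∣m⇒∣n (subst (p ∣_) (+-comm 1 (m * n)) p∣1+mn) (∣m⇒∣m*n n p∣m))

p∣m^n⇒p∣m : ∀ {p m} n → Prime p → p ∣ m ^ n → p ∣ m
p∣m^n⇒p∣m zero    p-prime p∣1 = contradiction p∣1 (prime⇒∤1 p-prime)
p∣m^n⇒p∣m {m = m} (suc n) p-prime p∣m*m^n with euclidsLemma m (m ^ n) p-prime p∣m*m^n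
... | inj₁ p∣m   = p∣m
... | inj₂ p∣m^n = p∣m^n⇒p∣m n p-prime p∣m^n

p∣m+n⇒p∣m*n⇒p∣m×p∣n : ∀ {p m n} → Prime p → p ∣ m + n → p ∣ m * n → p ∣ m × p ∣ n
p∣m+n⇒p∣m*n⇒p∣m×p∣n {p} {m} {n} p-prime p∣m+n p∣mn with euclidsLemma m n p-prime p∣mn
... | inj₁ p∣m = p∣m , ∣m+n∣m⇒∣n p∣m+n p∣m
... | inj₂ p∣n = ∣m+n∣m⇒∣n (subst (p ∣_) (+-comm m n) p∣m+n) p∣n , p∣n

p^k∣m*n⇒p^k∣n : ∀ {p m n} k → Prime p → p ∤ m → p ^ k ∣ m * n → p ^ k ∣ n
p^k∣m*n⇒p^k∣n zero _ _ _ = 1∣ _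
p^k∣m*n⇒p^k∣n {p} {m} {n} (suc k) p-prime p∤m p^[1+k]∣mn
  with euclidsLemma m n p-prime (∣-trans (m∣m*n (p ^ k)) p^[1+k]∣mn)
... | inj₁ p∣m = contradiction p∣m p∤m
... | inj₂ (divides n′ refl) =
  subst (p * p ^ k ∣_) (*-comm p n′) (*-monoʳ-∣ p (p^k∣m*n⇒p^k∣n k p-prime p∤m p^k∣mn′))
  where
  instance _ = prime⇒nonZero p-prime
  p^k∣mn′ : p ^ k ∣ m * n′
  p^k∣mn′ = *-cancelˡ-∣ p (subst (p * p ^ k ∣_) (trans (sym (*-assoc m n′ p)) (*-comm (m * n′) p)) p^[1+k]∣mn)

p^k∣m*n⇒p^k≤m+n : ∀ {p m n} k → Prime p → p ∤ m + n → 0 < m → 0 < n → p ^ k ∣ m * n → p ^ k ≤ m + n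
p^k∣m*n⇒p^k≤m+n {p} {m} {n} k p-prime p∤m+n 0<m 0<n p^k∣mn with p ∣? m
... | no p∤m  = ≤-trans (∣⇒≤ {{>-nonZero 0<n}} (p^k∣m*n⇒p^k∣n k p-prime p∤m p^k∣mn)) (m≤n+m n m)
... | yes p∣m = ≤-trans (∣⇒≤ {{>-nonZero 0<m}} (p^k∣m*n⇒p^k∣n k p-prime p∤n (subst (p ^ k ∣_) (*-comm m n) p^k∣mn)))
                        (m≤m+n m n)
  where
  p∤n : p ∤ n
  p∤n p∣n = p∤m+n (∣m∣n⇒∣m+n p∣m p∣n)

2∤n⇒2∣1+n : ∀ {n} → 2 ∤ n → 2 ∣ suc n
2∤n⇒2∣1+n {zero}        2∤0   = contradiction (2 ∣0) 2∤0
2∤n⇒2∣1+n {suc zero}    _     = ∣-refl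
2∤n⇒2∣1+n {suc (suc n)} 2∤2+n = ∣m∣n⇒∣m+n (∣-refl {2}) (2∤n⇒2∣1+n (2∤2+n ∘ ∣m∣n⇒∣m+n ∣-refl))

2∣m*k*[1+m^[1+n]] : ∀ m k n → 2 ∣ m * k * suc (m ^ suc n)
2∣m*k*[1+m^[1+n]] m k n with 2 ∣? m
... | yes 2∣m = ∣m⇒∣m*n _ (∣m⇒∣m*n k 2∣m)
... | no 2∤m  = ∣n⇒∣m*n (m * k) (2∤n⇒2∣1+n (2∤m ∘ p∣m^n⇒p∣m (suc n) prime[2]))

2<2^[1+m]⇒4∣2^[1+m] : ∀ m → 2 < 2 ^ suc m → 4 ∣ 2 ^ suc m
2<2^[1+m]⇒4∣2^[1+m] zero    2<2 = contradiction 2<2 (<-irrefl refl)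
2<2^[1+m]⇒4∣2^[1+m] (suc m) _   = divides (2 ^ m) (trans (sym (*-assoc 2 2 (2 ^ m))) (*-comm 4 (2 ^ m)))

4∣m⇒m%8≢6 : ∀ {m} → 4 ∣ m → m % 8 ≢ 6
4∣m⇒m%8≢6 4∣m m%8≡6 = toWitnessFalse {a? = 4 ∣? 6} _ (subst (4 ∣_) m%8≡6 (%-presˡ-∣ 4∣m (divides 2 refl)))

m*m≡n*n+k⇒n≤m : ∀ {m n k} → m * m ≡ n * n + k → n ≤ m
m*m≡n*n+k⇒n≤m {m} {n} {k} eq with n ≤? m
... | yes n≤m = n≤m
... | no n≰m  = contradiction eq (<⇒≢ (begin-strict
  m * m      <⟨ *-mono-< m<n m<n ⟩
  n * n      ≤⟨ m≤m+n (n * n) k ⟩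
  n * n + k  ∎))
  where
  open ≤-Reasoning
  m<n = ≰⇒> n≰m

difference-of-squares : ∀ {m n k} → m * m ≡ n * n + k → Σ[ a ∈ ℕ ] a + n ≡ m × a * (m + n) ≡ k
difference-of-squares {m} {n} {k} eq with m≤n⇒∃[o]m+o≡n {n} {m} (m*m≡n*n+k⇒n≤m eq)
... | a , refl = a , +-comm a n , +-cancelˡ-≡ (n * n) _ _ (begin
  n * n + a * (n + a + n)  ≡⟨ solve (n ∷ a ∷ []) ⟩
  (n + a) * (n + a)        ≡⟨ eq ⟩
  n * n + k                ∎)
  where open ≡-Reasoning

x*x≡+∣x∣*∣x∣ : ∀ x → x ℤ.* x ≡ + (ℤ.∣ x ∣ * ℤ.∣ x ∣)
x*x≡+∣x∣*∣x∣ (+ n)      = sym (pos-* n n)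
x*x≡+∣x∣*∣x∣ ℤ.-[1+ n ] = refl

+m*+m-+k*+l≡x*x⇒m*m≡∣x∣*∣x∣+k*l : ∀ {m k l x} → (+ m) ℤ.* (+ m) ℤ.- (+ k) ℤ.* (+ l) ≡ x ℤ.* x →
                                   m * m ≡ ℤ.∣ x ∣ * ℤ.∣ x ∣ + k * l
+m*+m-+k*+l≡x*x⇒m*m≡∣x∣*∣x∣+k*l {m} {k} {l} {x} m²-kl≡x² = ℤ.+-injective (begin
  + (m * m)                                         ≡⟨ pos-* m m ⟩
  + m ℤ.* + m                                       ≡⟨ ℤ.+-identityʳ _ ⟨
  + m ℤ.* + m ℤ.+ + 0                               ≡⟨ cong (λ t → + m ℤ.* + m ℤ.+ t) (ℤ.+-inverseˡ (+ k ℤ.* + l)) ⟨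
  + m ℤ.* + m ℤ.+ (ℤ.- (+ k ℤ.* + l) ℤ.+ + k ℤ.* + l) ≡⟨ ℤ.+-assoc (+ m ℤ.* + m) _ _ ⟨
  + m ℤ.* + m ℤ.- + k ℤ.* + l ℤ.+ + k ℤ.* + l       ≡⟨ cong₂ ℤ._+_ m²-kl≡x² (sym (pos-* k l)) ⟩
  x ℤ.* x ℤ.+ + (k * l)                             ≡⟨ cong (ℤ._+ + (k * l)) (x*x≡+∣x∣*∣x∣ x) ⟩
  + (ℤ.∣ x ∣ * ℤ.∣ x ∣) ℤ.+ + (k * l)               ∎)
  where open ≡-Reasoning

gsum-suc : ∀ q n → gsum q (suc n) ≡ suc (q * gsum q n)
gsum-suc q zero    = cong suc (sym (*-zeroʳ q))
gsum-suc q (suc n) = begin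
  gsum q (suc n) + q ^ suc n        ≡⟨ cong (_+ q ^ suc n) (gsum-suc q n) ⟩
  suc (q * gsum q n + q * q ^ n)    ≡⟨ cong suc (*-distribˡ-+ q (gsum q n) (q ^ n)) ⟨
  suc (q * gsum q (suc n))          ∎
  where open ≡-Reasoning

gsum-+ : ∀ q m n → gsum q (m + n) ≡ gsum q m + q ^ m * gsum q n
gsum-+ q m zero    = begin
  gsum q (m + 0)                    ≡⟨ cong (gsum q) (+-identityʳ m) ⟩
  gsum q m                          ≡⟨ +-identityʳ (gsum q m) ⟨
  gsum q m + 0                      ≡⟨ cong (λ t → gsum q m + t) (*-zeroʳ (q ^ m)) ⟨
  gsum q m + q ^ m * 0              ∎
  where open ≡-Reasoning
gsum-+ q m (suc n) = begin
  gsum q (m + suc n)                            ≡⟨ cong (gsum q) (+-suc m n) ⟩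
  gsum q (m + n) + q ^ (m + n)                  ≡⟨ cong₂ _+_ (gsum-+ q m n) (^-distribˡ-+-* q m n) ⟩
  gsum q m + q ^ m * gsum q n + q ^ m * q ^ n   ≡⟨ +-assoc (gsum q m) _ _ ⟩
  gsum q m + (q ^ m * gsum q n + q ^ m * q ^ n) ≡⟨ cong (λ t → gsum q m + t) (*-distribˡ-+ (q ^ m) (gsum q n) (q ^ n)) ⟨
  gsum q m + q ^ m * gsum q (suc n)             ∎
  where open ≡-Reasoning

gsum-2* : ∀ q n → gsum q (2 * n) ≡ suc (q ^ n) * gsum q n
gsum-2* q n = trans (cong (λ t → gsum q (n + t)) (+-identityʳ n)) (gsum-+ q n n)

2*gsum[1+n]<q^[1+n] : ∀ {q} n → 2 < q → 2 * gsum q (suc n) < q ^ suc n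
2*gsum[1+n]<q^[1+n] {q} n 2<q = +-cancelʳ-< (q * gsum q n) _ _ (begin-strict
  2 * gsum q (suc n) + q * gsum q n       ≡⟨ cong (λ t → 2 * t + q * gsum q n) (gsum-suc q n) ⟩
  2 * suc (q * gsum q n) + q * gsum q n   <⟨ 2[1+c]+c<q[1+c] (q * gsum q n) ⟩
  q * suc (q * gsum q n)                  ≡⟨ cong (q *_) (gsum-suc q n) ⟨
  q * (gsum q n + q ^ n)                  ≡⟨ *-distribˡ-+ q (gsum q n) (q ^ n) ⟩
  q * gsum q n + q ^ suc n                ≡⟨ +-comm (q * gsum q n) (q ^ suc n) ⟩
  q ^ suc n + q * gsum q n                ∎)
  where
  open ≤-Reasoning
  2[1+c]+c<q[1+c] : ∀ c → 2 * suc c + c < q * suc c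
  2[1+c]+c<q[1+c] c = begin-strict
    2 * suc c + c   ≡⟨ solve (c ∷ []) ⟩
    2 + 3 * c       <⟨ +-mono-<-≤ 2<q (*-monoˡ-≤ c 2<q) ⟩
    q + q * c       ≡⟨ solve (q ∷ c ∷ []) ⟩
    q * suc c       ∎

toℚᵘ-⟦⟧ℤ : ∀ i → toℚᵘ ⟦ i ⟧ℤ ℚᵘ.≃ mkℚᵘ i 0
toℚᵘ-⟦⟧ℤ i = toℚᵘ-fromℚᵘ (mkℚᵘ i 0)

⟦⟧ℤ-homo-+ : ∀ i j → ⟦ i ℤ.+ j ⟧ℤ ≡ ⟦ i ⟧ℤ ℚ.+ ⟦ j ⟧ℤ
⟦⟧ℤ-homo-+ i j = toℚᵘ-injective (begin
  toℚᵘ ⟦ i ℤ.+ j ⟧ℤ                ≈⟨ toℚᵘ-⟦⟧ℤ (i ℤ.+ j) ⟩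
  mkℚᵘ (i ℤ.+ j) 0                 ≈⟨ *≡* (cong (ℤ._* + 1) (sym (cong₂ ℤ._+_ (ℤ.*-identityʳ i) (ℤ.*-identityʳ j)))) ⟩
  mkℚᵘ i 0 ℚᵘ.+ mkℚᵘ j 0           ≈⟨ ℚᵘ.+-cong (toℚᵘ-⟦⟧ℤ i) (toℚᵘ-⟦⟧ℤ j) ⟨
  toℚᵘ ⟦ i ⟧ℤ ℚᵘ.+ toℚᵘ ⟦ j ⟧ℤ      ≈⟨ toℚᵘ-homo-+ ⟦ i ⟧ℤ ⟦ j ⟧ℤ ⟨
  toℚᵘ (⟦ i ⟧ℤ ℚ.+ ⟦ j ⟧ℤ)          ∎)
  where open ℚᵘ.≃-Reasoning

⟦⟧ℤ-homo-* : ∀ i j → ⟦ i ℤ.* j ⟧ℤ ≡ ⟦ i ⟧ℤ ℚ.* ⟦ j ⟧ℤ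
⟦⟧ℤ-homo-* i j = toℚᵘ-injective (begin
  toℚᵘ ⟦ i ℤ.* j ⟧ℤ                ≈⟨ toℚᵘ-⟦⟧ℤ (i ℤ.* j) ⟩
  mkℚᵘ i 0 ℚᵘ.* mkℚᵘ j 0           ≈⟨ ℚᵘ.*-cong (toℚᵘ-⟦⟧ℤ i) (toℚᵘ-⟦⟧ℤ j) ⟨
  toℚᵘ ⟦ i ⟧ℤ ℚᵘ.* toℚᵘ ⟦ j ⟧ℤ      ≈⟨ toℚᵘ-homo-* ⟦ i ⟧ℤ ⟦ j ⟧ℤ ⟨
  toℚᵘ (⟦ i ⟧ℤ ℚ.* ⟦ j ⟧ℤ)          ∎)
  where open ℚᵘ.≃-Reasoning

⟦⟧ℤ-injective : ∀ {i j} → ⟦ i ⟧ℤ ≡ ⟦ j ⟧ℤ → i ≡ j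
⟦⟧ℤ-injective {i} {j} eq
  with ℚᵘ.≃-trans (ℚᵘ.≃-sym (toℚᵘ-⟦⟧ℤ i)) (ℚᵘ.≃-trans (toℚᵘ-cong eq) (toℚᵘ-⟦⟧ℤ j))
... | *≡* i*1≡j*1 = trans (sym (ℤ.*-identityʳ i)) (trans i*1≡j*1 (ℤ.*-identityʳ j))

⟦⟧ℕ-homo-+ : ∀ m n → ⟦ m + n ⟧ℕ ≡ ⟦ m ⟧ℕ ℚ.+ ⟦ n ⟧ℕ
⟦⟧ℕ-homo-+ m n = ⟦⟧ℤ-homo-+ (+ m) (+ n)

⟦⟧ℕ-homo-* : ∀ m n → ⟦ m * n ⟧ℕ ≡ ⟦ m ⟧ℕ ℚ.* ⟦ n ⟧ℕ
⟦⟧ℕ-homo-* m n = trans (cong ⟦_⟧ℤ (pos-* m n)) (⟦⟧ℤ-homo-* (+ m) (+ n))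

⟦⟧ℕ-injective : ∀ {m n} → ⟦ m ⟧ℕ ≡ ⟦ n ⟧ℕ → m ≡ n
⟦⟧ℕ-injective = ℤ.+-injective ∘ ⟦⟧ℤ-injective

-- The integers (λ, r, k) of one root, v = f + 1 and D = (ρ - σ)μ; RK≡Λf+R is r(k - 1) = λ(v - 1)
-- rearranged to avoid truncated subtraction.
record RootParameters (b f D : ℕ) : Set where
  field
    Λ R K : ℕ
    R≡Λ+D : R ≡ Λ + D
    bK≡Rv : b * K ≡ R * suc f
    RK≡Λf+R : R * K ≡ Λ * f + R

open RootParameters

module _ {ρ σ : ℤ} {f g μ : ℕ} where
  open Feas ρ σ f g μ
  open +-*-Solver renaming (solve to ℚ-solve)

  IsRoot⇒IsRoot[B-x] : ∀ x → IsRoot x → IsRoot (B ℚ.- x)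
  IsRoot⇒IsRoot[B-x] x = trans (ℚ-solve 3 (λ b x c → ((b :- x) :* (b :- x) :- b :* (b :- x)) :+ c
                                                  := (x :* x :- b :* x) :+ c) refl B x C)

  module _ {δ : ℕ} (ρ-σ≡δ : ρ ℤ.- σ ≡ + δ) where

    Dμ≡δμ : Dμ ≡ ⟦ δ * μ ⟧ℕ
    Dμ≡δμ = cong ⟦_⟧ℤ (trans (cong (ℤ._* + μ) ρ-σ≡δ) (sym (pos-* δ μ)))

    good⇒rootParameters : ∀ {x} → Good x → Σ[ p ∈ RootParameters (suc (f + g)) f (δ * μ) ] x ≡ ⟦ Λ p ⟧ℕ
    good⇒rootParameters {x} ((l′ , x≡l′) , (r′ , rx≡r′) , _ , _ , (k′ , kx≡k′) , bk≡rv , r[k-1]≡x[v-1]) =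
      record { Λ = l′ ; R = r′ ; K = k′ ; R≡Λ+D = r′≡l′+δμ ; bK≡Rv = bk′≡r′v ; RK≡Λf+R = r′k′≡l′f+r′ } , x≡l′
      where
      open ≡-Reasoning
      r′≡l′+δμ : r′ ≡ l′ + δ * μ
      r′≡l′+δμ = ⟦⟧ℕ-injective (begin
        ⟦ r′ ⟧ℕ                      ≡⟨ rx≡r′ ⟨
        x ℚ.+ Dμ                     ≡⟨ cong₂ ℚ._+_ x≡l′ Dμ≡δμ ⟩
        ⟦ l′ ⟧ℕ ℚ.+ ⟦ δ * μ ⟧ℕ       ≡⟨ ⟦⟧ℕ-homo-+ l′ (δ * μ) ⟨
        ⟦ l′ + δ * μ ⟧ℕ              ∎)
      bk′≡r′v : suc (f + g) * k′ ≡ r′ * suc f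
      bk′≡r′v = ⟦⟧ℕ-injective (begin
        ⟦ suc (f + g) * k′ ⟧ℕ        ≡⟨ ⟦⟧ℕ-homo-* (suc (f + g)) k′ ⟩
        bℚ ℚ.* ⟦ k′ ⟧ℕ               ≡⟨ cong (bℚ ℚ.*_) kx≡k′ ⟨
        bℚ ℚ.* k x                   ≡⟨ bk≡rv ⟩
        r x ℚ.* vℚ                   ≡⟨ cong (ℚ._* vℚ) rx≡r′ ⟩
        ⟦ r′ ⟧ℕ ℚ.* vℚ               ≡⟨ ⟦⟧ℕ-homo-* r′ (suc f) ⟨
        ⟦ r′ * suc f ⟧ℕ              ∎)
      r′k′≡l′f+r′ : r′ * k′ ≡ l′ * f + r′
      r′k′≡l′f+r′ = ⟦⟧ℕ-injective (begin
        ⟦ r′ * k′ ⟧ℕ                                   ≡⟨ ⟦⟧ℕ-homo-* r′ k′ ⟩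
        ⟦ r′ ⟧ℕ ℚ.* ⟦ k′ ⟧ℕ                            ≡⟨ cong₂ ℚ._*_ rx≡r′ kx≡k′ ⟨
        r x ℚ.* k x                                    ≡⟨ ℚ-solve 2 (λ a b → a :* b := a :* (b :- con 1ℚ) :+ a) refl (r x) (k x) ⟩
        r x ℚ.* (k x ℚ.- 1ℚ) ℚ.+ r x                   ≡⟨ cong₂ ℚ._+_ r[k-1]≡x[v-1] rx≡r′ ⟩
        x ℚ.* (vℚ ℚ.- 1ℚ) ℚ.+ ⟦ r′ ⟧ℕ                  ≡⟨ cong₂ (λ a b → a ℚ.* (b ℚ.- 1ℚ) ℚ.+ ⟦ r′ ⟧ℕ) x≡l′ (⟦⟧ℕ-homo-+ 1 f) ⟩
        ⟦ l′ ⟧ℕ ℚ.* ((1ℚ ℚ.+ ⟦ f ⟧ℕ) ℚ.- 1ℚ) ℚ.+ ⟦ r′ ⟧ℕ ≡⟨ ℚ-solve 3 (λ a b c → a :* ((con 1ℚ :+ b) :- con 1ℚ) :+ c := a :* b :+ c)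
                                                                 refl ⟦ l′ ⟧ℕ ⟦ f ⟧ℕ ⟦ r′ ⟧ℕ ⟩
        ⟦ l′ ⟧ℕ ℚ.* ⟦ f ⟧ℕ ℚ.+ ⟦ r′ ⟧ℕ                  ≡⟨ cong (ℚ._+ ⟦ r′ ⟧ℕ) (⟦⟧ℕ-homo-* l′ f) ⟨
        ⟦ l′ * f ⟧ℕ ℚ.+ ⟦ r′ ⟧ℕ                         ≡⟨ ⟦⟧ℕ-homo-+ (l′ * f) r′ ⟨
        ⟦ l′ * f + r′ ⟧ℕ                                ∎)

    Λ+Λ′+2δμ≡b : ∀ {x} (p p′ : RootParameters (suc (f + g)) f (δ * μ)) → x ≡ ⟦ Λ p ⟧ℕ → B ℚ.- x ≡ ⟦ Λ p′ ⟧ℕ →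
                 Λ p + Λ p′ + 2 * (δ * μ) ≡ suc (f + g)
    Λ+Λ′+2δμ≡b {x} p p′ x≡Λ B-x≡Λ′ = ⟦⟧ℕ-injective (begin
      ⟦ Λ p + Λ p′ + 2 * (δ * μ) ⟧ℕ                      ≡⟨ ⟦⟧ℕ-homo-+ (Λ p + Λ p′) (2 * (δ * μ)) ⟩
      ⟦ Λ p + Λ p′ ⟧ℕ ℚ.+ ⟦ 2 * (δ * μ) ⟧ℕ                ≡⟨ cong₂ ℚ._+_ (⟦⟧ℕ-homo-+ (Λ p) (Λ p′)) (⟦⟧ℕ-homo-* 2 (δ * μ)) ⟩
      (⟦ Λ p ⟧ℕ ℚ.+ ⟦ Λ p′ ⟧ℕ) ℚ.+ ⟦ 2 ⟧ℕ ℚ.* ⟦ δ * μ ⟧ℕ   ≡⟨ cong₂ (λ a b → (a ℚ.+ b) ℚ.+ ⟦ 2 ⟧ℕ ℚ.* ⟦ δ * μ ⟧ℕ) x≡Λ B-x≡Λ′ ⟨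
      (x ℚ.+ (B ℚ.- x)) ℚ.+ ⟦ 2 ⟧ℕ ℚ.* ⟦ δ * μ ⟧ℕ         ≡⟨ cong (λ d → (x ℚ.+ (B ℚ.- x)) ℚ.+ ⟦ 2 ⟧ℕ ℚ.* d) Dμ≡δμ ⟨
      (x ℚ.+ (B ℚ.- x)) ℚ.+ ⟦ 2 ⟧ℕ ℚ.* Dμ                 ≡⟨ ℚ-solve 4 (λ x b t d → (x :+ ((b :- t :* d) :- x)) :+ t :* d := b)
                                                                      refl x bℚ ⟦ 2 ⟧ℕ Dμ ⟩
      bℚ                                                 ∎)
      where open ≡-Reasoning

    feasible⇒rootParameters : Feasible →
      Σ[ p ∈ RootParameters (suc (f + g)) f (δ * μ) ] Σ[ p′ ∈ RootParameters (suc (f + g)) f (δ * μ) ]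
        Λ p + Λ p′ + 2 * (δ * μ) ≡ suc (f + g)
    feasible⇒rootParameters ((x , x-root) , good) =
      let p  , x≡Λ    = good⇒rootParameters (good x x-root)
          p′ , B-x≡Λ′ = good⇒rootParameters (good (B ℚ.- x) (IsRoot⇒IsRoot[B-x] x x-root))
      in  p , p′ , Λ+Λ′+2δμ≡b p p′ x≡Λ B-x≡Λ′

module _ {b f D : ℕ} where

  R+R′≡b : (x y : RootParameters b f D) → Λ x + Λ y + 2 * D ≡ b → R x + R y ≡ b
  R+R′≡b record { Λ = Λ₁ ; R = R₁ ; R≡Λ+D = R₁≡Λ₁+D } record { Λ = Λ₂ ; R = R₂ ; R≡Λ+D = R₂≡Λ₂+D } Λ₁+Λ₂+2D≡b = begin
    R₁ + R₂                 ≡⟨ cong₂ _+_ R₁≡Λ₁+D R₂≡Λ₂+D ⟩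
    (Λ₁ + D) + (Λ₂ + D)     ≡⟨ solve (Λ₁ ∷ Λ₂ ∷ D ∷ []) ⟩
    Λ₁ + Λ₂ + 2 * D         ≡⟨ Λ₁+Λ₂+2D≡b ⟩
    b                       ∎
    where open ≡-Reasoning

  vRR′≡bfD : (x y : RootParameters b f D) → Λ x + Λ y + 2 * D ≡ b → suc f * (R x * R y) ≡ b * f * D
  vRR′≡bfD x@record { Λ = Λ₁ ; R = R₁ ; K = K₁ ; R≡Λ+D = R₁≡Λ₁+D ; bK≡Rv = bK₁≡R₁v ; RK≡Λf+R = R₁K₁≡Λ₁f+R₁ }
           y@record { R = R₂ } Λ₁+Λ₂+2D≡b = +-cancelʳ-≡ (b * (Λ₁ * f + R₁)) _ _ (begin
    suc f * (R₁ * R₂) + b * (Λ₁ * f + R₁)   ≡⟨ cong (λ t → suc f * (R₁ * R₂) + b * t) R₁K₁≡Λ₁f+R₁ ⟨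
    suc f * (R₁ * R₂) + b * (R₁ * K₁)       ≡⟨ solve (f ∷ R₁ ∷ R₂ ∷ b ∷ K₁ ∷ []) ⟩
    suc f * (R₁ * R₂) + R₁ * (b * K₁)       ≡⟨ cong (λ t → suc f * (R₁ * R₂) + R₁ * t) bK₁≡R₁v ⟩
    suc f * (R₁ * R₂) + R₁ * (R₁ * suc f)   ≡⟨ solve (f ∷ R₁ ∷ R₂ ∷ []) ⟩
    suc f * R₁ * (R₁ + R₂)                  ≡⟨ cong (suc f * R₁ *_) (R+R′≡b x y Λ₁+Λ₂+2D≡b) ⟩
    suc f * R₁ * b                          ≡⟨ cong (λ t → suc f * t * b) R₁≡Λ₁+D ⟩
    suc f * (Λ₁ + D) * b                    ≡⟨ solve (f ∷ Λ₁ ∷ D ∷ b ∷ []) ⟩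
    b * f * D + b * (Λ₁ * f + (Λ₁ + D))     ≡⟨ cong (λ t → b * f * D + b * (Λ₁ * f + t)) R₁≡Λ₁+D ⟨
    b * f * D + b * (Λ₁ * f + R₁)           ∎)
    where open ≡-Reasoning

module RootWeights {f g Q c D : ℕ} (2f≡c[1+Q] : 2 * f ≡ c * suc Q) (g≡f+Q : g ≡ f + Q) where
  open ≡-Reasoning

  b≡[1+Q][1+c] : suc (f + g) ≡ suc Q * suc c
  b≡[1+Q][1+c] = begin
    suc (f + g)          ≡⟨ cong (λ t → suc (f + t)) g≡f+Q ⟩
    suc (f + (f + Q))    ≡⟨ solve (f ∷ Q ∷ []) ⟩
    suc (2 * f + Q)      ≡⟨ cong (λ t → suc (t + Q)) 2f≡c[1+Q] ⟩
    suc (c * suc Q + Q)  ≡⟨ solve (c ∷ Q ∷ []) ⟩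
    suc Q * suc c        ∎

  [1+Q]∣2R : (x : RootParameters (suc (f + g)) f D) → suc Q ∣ 2 * R x
  [1+Q]∣2R record { R = r ; K = k ; bK≡Rv = bk≡rv } = ∣m+n∣m⇒∣n (divides (2 * suc c * k) (begin
    r * c * suc Q + 2 * r      ≡⟨ solve (r ∷ c ∷ Q ∷ []) ⟩
    r * (c * suc Q) + 2 * r    ≡⟨ cong (λ t → r * t + 2 * r) 2f≡c[1+Q] ⟨
    r * (2 * f) + 2 * r        ≡⟨ solve (r ∷ f ∷ []) ⟩
    2 * (r * suc f)            ≡⟨ cong (2 *_) bk≡rv ⟨
    2 * (suc (f + g) * k)      ≡⟨ cong (λ t → 2 * (t * k)) b≡[1+Q][1+c] ⟩
    2 * (suc Q * suc c * k)    ≡⟨ solve (Q ∷ c ∷ k ∷ []) ⟩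
    2 * suc c * k * suc Q      ∎)) (n∣m*n (r * c))

  w : RootParameters (suc (f + g)) f D → ℕ
  w x = quotient ([1+Q]∣2R x)

  2R≡w[1+Q] : (x : RootParameters (suc (f + g)) f D) → 2 * R x ≡ w x * suc Q
  2R≡w[1+Q] x = m∣n⇒n≡quotient*m ([1+Q]∣2R x)

  w>0 : 0 < D → (x : RootParameters (suc (f + g)) f D) → 0 < w x
  w>0 0<D x = m*n>0⇒m>0 (w x) (subst (0 <_) (2R≡w[1+Q] x) 0<2R)
    where
    0<R : 0 < R x
    0<R = subst (0 <_) (sym (R≡Λ+D x)) (<-≤-trans 0<D (m≤n+m D (Λ x)))
    0<2R : 0 < 2 * R x
    0<2R = <-≤-trans 0<R (m≤n*m (R x) 2)

  w+w′≡2[1+c] : ∀ {R₁ R₂ w₁ w₂} → 2 * R₁ ≡ w₁ * suc Q → 2 * R₂ ≡ w₂ * suc Q → R₁ + R₂ ≡ suc (f + g) →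
                w₁ + w₂ ≡ 2 * suc c
  w+w′≡2[1+c] {R₁} {R₂} {w₁} {w₂} 2R₁≡w₁[1+Q] 2R₂≡w₂[1+Q] R₁+R₂≡b = *-cancelʳ-≡ _ _ (suc Q) (begin
    (w₁ + w₂) * suc Q          ≡⟨ solve (w₁ ∷ w₂ ∷ Q ∷ []) ⟩
    w₁ * suc Q + w₂ * suc Q    ≡⟨ cong₂ _+_ 2R₁≡w₁[1+Q] 2R₂≡w₂[1+Q] ⟨
    2 * R₁ + 2 * R₂            ≡⟨ *-distribˡ-+ 2 R₁ R₂ ⟨
    2 * (R₁ + R₂)              ≡⟨ cong (2 *_) (trans R₁+R₂≡b b≡[1+Q][1+c]) ⟩
    2 * (suc Q * suc c)        ≡⟨ solve (Q ∷ c ∷ []) ⟩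
    2 * suc c * suc Q          ∎)

  vww′≡2[1+c]cD : ∀ {R₁ R₂ w₁ w₂} → 2 * R₁ ≡ w₁ * suc Q → 2 * R₂ ≡ w₂ * suc Q →
                  suc f * (R₁ * R₂) ≡ suc (f + g) * f * D → suc f * (w₁ * w₂) ≡ 2 * (suc c * c * D)
  vww′≡2[1+c]cD {R₁} {R₂} {w₁} {w₂} 2R₁≡w₁[1+Q] 2R₂≡w₂[1+Q] vR₁R₂≡bfD = *-cancelʳ-≡ _ _ (suc Q * suc Q) (begin
    suc f * (w₁ * w₂) * (suc Q * suc Q)        ≡⟨ solve (f ∷ w₁ ∷ w₂ ∷ Q ∷ []) ⟩
    suc f * ((w₁ * suc Q) * (w₂ * suc Q))      ≡⟨ cong₂ (λ s t → suc f * (s * t)) 2R₁≡w₁[1+Q] 2R₂≡w₂[1+Q] ⟨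
    suc f * ((2 * R₁) * (2 * R₂))              ≡⟨ solve (f ∷ R₁ ∷ R₂ ∷ []) ⟩
    4 * (suc f * (R₁ * R₂))                    ≡⟨ cong (4 *_) vR₁R₂≡bfD ⟩
    4 * (suc (f + g) * f * D)                  ≡⟨ cong (λ t → 4 * (t * f * D)) b≡[1+Q][1+c] ⟩
    4 * (suc Q * suc c * f * D)                ≡⟨ solve (Q ∷ c ∷ f ∷ D ∷ []) ⟩
    2 * (suc Q * suc c * (2 * f) * D)          ≡⟨ cong (λ t → 2 * (suc Q * suc c * t * D)) 2f≡c[1+Q] ⟩
    2 * (suc Q * suc c * (c * suc Q) * D)      ≡⟨ solve (Q ∷ c ∷ D ∷ []) ⟩
    2 * (suc c * c * D) * (suc Q * suc Q)      ∎)

multiplicities : ∀ {Q c} → 2 ∣ c * suc Q →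
  let N = suc Q * suc c ∸ 1 in 2 * ((N ∸ Q) / 2) ≡ c * suc Q × (N + Q) / 2 ≡ (N ∸ Q) / 2 + Q
multiplicities {Q} {c} (divides h c[1+Q]≡h*2) = 2[N∸Q]/2≡c[1+Q] , [N+Q]/2≡[N∸Q]/2+Q
  where
  open ≡-Reasoning
  N≡h*2+Q : c + Q * suc c ≡ h * 2 + Q
  N≡h*2+Q = begin
    c + Q * suc c   ≡⟨ solve (c ∷ Q ∷ []) ⟩
    c * suc Q + Q   ≡⟨ cong (_+ Q) c[1+Q]≡h*2 ⟩
    h * 2 + Q       ∎
  [N∸Q]/2≡h : (c + Q * suc c ∸ Q) / 2 ≡ h
  [N∸Q]/2≡h = begin
    (c + Q * suc c ∸ Q) / 2   ≡⟨ cong (λ t → (t ∸ Q) / 2) N≡h*2+Q ⟩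
    (h * 2 + Q ∸ Q) / 2       ≡⟨ cong (_/ 2) (m+n∸n≡m (h * 2) Q) ⟩
    h * 2 / 2                 ≡⟨ m*n/n≡m h 2 ⟩
    h                         ∎
  2[N∸Q]/2≡c[1+Q] : 2 * ((c + Q * suc c ∸ Q) / 2) ≡ c * suc Q
  2[N∸Q]/2≡c[1+Q] = trans (cong (2 *_) [N∸Q]/2≡h) (trans (*-comm 2 h) (sym c[1+Q]≡h*2))
  h*2+Q+Q≡[h+Q]*2 : h * 2 + Q + Q ≡ (h + Q) * 2
  h*2+Q+Q≡[h+Q]*2 = solve (h ∷ Q ∷ [])
  [N+Q]/2≡[N∸Q]/2+Q : (c + Q * suc c + Q) / 2 ≡ (c + Q * suc c ∸ Q) / 2 + Q
  [N+Q]/2≡[N∸Q]/2+Q = begin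
    (c + Q * suc c + Q) / 2           ≡⟨ cong (λ t → (t + Q) / 2) N≡h*2+Q ⟩
    (h * 2 + Q + Q) / 2               ≡⟨ cong (_/ 2) h*2+Q+Q≡[h+Q]*2 ⟩
    (h + Q) * 2 / 2                   ≡⟨ m*n/n≡m (h + Q) 2 ⟩
    h + Q                             ≡⟨ cong (_+ Q) [N∸Q]/2≡h ⟨
    (c + Q * suc c ∸ Q) / 2 + Q       ∎

module _ (q e : ℕ) where
  open SpSpectrum (suc e) q

  sp-ρ-σ : ρ ℤ.- σ ≡ + (q ^ e + q ^ e)
  sp-ρ-σ = cong (ℤ._+_ (+ (q ^ e))) (neg-involutive (+ (q ^ e)))

  sp-nV : nV ≡ suc (q ^ suc e) * suc (q * gsum q e)
  sp-nV = trans (gsum-2* q (suc e)) (cong (suc (q ^ suc e) *_) (gsum-suc q e))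

  sp-f-g : 2 * f ≡ q * gsum q e * suc (q ^ suc e) × g ≡ f + q ^ suc e
  sp-f-g = subst (λ N → 2 * ((N ∸ 1 ∸ q ^ suc e) / 2) ≡ q * gsum q e * suc (q ^ suc e)
                      × (N ∸ 1 + q ^ suc e) / 2 ≡ (N ∸ 1 ∸ q ^ suc e) / 2 + q ^ suc e)
                 (sym sp-nV) (multiplicities {q ^ suc e} {q * gsum q e} (2∣m*k*[1+m^[1+n]] q (gsum q e) e))

-- With d = e + 1, G = gsum q d, H = gsum q e and Q = q^d: v = f + 1 and the integers w = 2r/(Q + 1)
-- of the two roots of a feasible (Sp(2d,q), μ).
record Factorisation (q e μ : ℕ) : Set where
  field
    v w₁ w₂ : ℕ
    2v≡qH[1+Q]+2 : 2 * v ≡ q * gsum q e * suc (q ^ suc e) + 2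
    w₁>0 : 0 < w₁
    w₂>0 : 0 < w₂
    w₁+w₂≡2G : w₁ + w₂ ≡ 2 * gsum q (suc e)
    vw₁w₂≡4QμGH : v * (w₁ * w₂) ≡ 4 * (q ^ suc e * (μ * gsum q (suc e) * gsum q e))

module _ {q e μ : ℕ} where
  open SpSpectrum (suc e) q

  rootParameters⇒factorisation : 0 < q → 0 < μ → (x y : RootParameters (suc (f + g)) f ((q ^ e + q ^ e) * μ)) →
    Λ x + Λ y + 2 * ((q ^ e + q ^ e) * μ) ≡ suc (f + g) → Factorisation q e μ
  rootParameters⇒factorisation 0<q 0<μ x y Λ+Λ′+2D≡b = record
    { v = suc f
    ; w₁ = w x
    ; w₂ = w y
    ; 2v≡qH[1+Q]+2 = trans (*-suc 2 f) (trans (+-comm 2 (2 * f)) (cong (_+ 2) 2f≡c[1+Q]))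
    ; w₁>0 = w>0 0<D x
    ; w₂>0 = w>0 0<D y
    ; w₁+w₂≡2G = trans (w+w′≡2[1+c] {R x} {R y} {w x} {w y} (2R≡w[1+Q] x) (2R≡w[1+Q] y) (R+R′≡b x y Λ+Λ′+2D≡b))
                       (cong (2 *_) (sym (gsum-suc q e)))
    ; vw₁w₂≡4QμGH = trans (vww′≡2[1+c]cD {R x} {R y} {w x} {w y} (2R≡w[1+Q] x) (2R≡w[1+Q] y) (vRR′≡bfD x y Λ+Λ′+2D≡b))
                          (trans (cong (λ G → 2 * (G * (q * gsum q e) * D)) (sym (gsum-suc q e)))
                                 (regroup (gsum q (suc e)) (gsum q e) (q ^ e)))
    }
    where
    D : ℕ
    D = (q ^ e + q ^ e) * μ
    2f≡c[1+Q] : 2 * f ≡ q * gsum q e * suc (q ^ suc e)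
    2f≡c[1+Q] = proj₁ (sp-f-g q e)
    open RootWeights {f} {g} {q ^ suc e} {q * gsum q e} {D} 2f≡c[1+Q] (proj₂ (sp-f-g q e))
    0<D : 0 < D
    0<D = *-mono-≤ (≤-trans (m^n>0 q {{>-nonZero 0<q}} e) (m≤m+n (q ^ e) (q ^ e))) 0<μ
    regroup : ∀ G H n → 2 * (G * (q * H) * ((n + n) * μ)) ≡ 4 * (q * n * (μ * G * H))
    regroup G H n = solve (G ∷ q ∷ H ∷ n ∷ μ ∷ [])

  feasibleSp⇒factorisation : 0 < q → 0 < μ → FeasibleSp (suc e) q μ → Factorisation q e μ
  feasibleSp⇒factorisation 0<q 0<μ feasible =
    let x , y , Λ+Λ′+2D≡b = feasible⇒rootParameters {ρ} {σ} {f} {g} {μ} (sp-ρ-σ q e) feasible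
    in  rootParameters⇒factorisation 0<q 0<μ x y Λ+Λ′+2D≡b

module _ {p m q e : ℕ} (p-prime : Prime p) (q≡p^[1+m] : q ≡ p ^ suc m) (2<q : 2 < q) where
  private
    G = gsum q (suc e)
    H = gsum q e
    Q = q ^ suc e

  p∣q : p ∣ q
  p∣q = subst (p ∣_) (sym q≡p^[1+m]) (m∣m*n (p ^ m))

  p∤G : p ∤ G
  p∤G = subst (p ∤_) (sym (gsum-suc q e)) (prime∣m⇒∤1+m*n H p-prime p∣q)

  Q≡p^K : Q ≡ p ^ (suc m * suc e)
  Q≡p^K = trans (cong (_^ suc e) q≡p^[1+m]) (^-*-assoc p (suc m) (suc e))

  Q∣v*n⇒Q∣n : ∀ {v n} → p ∤ v → Q ∣ v * n → Q ∣ n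
  Q∣v*n⇒Q∣n {v} {n} p∤v Q∣vn =
    subst (_∣ n) (sym Q≡p^K) (p^k∣m*n⇒p^k∣n (suc m * suc e) p-prime p∤v (subst (_∣ v * n) Q≡p^K Q∣vn))

  -- Since p ∤ a + c, the prime power Q must divide a or c outright, and 2G < Q leaves no room for that.
  Q∤a*c : ∀ {a c} → p ∤ a + c → 0 < a → 0 < c → a + c ≤ 2 * G → Q ∤ a * c
  Q∤a*c {a} {c} p∤a+c 0<a 0<c a+c≤2G Q∣ac = <⇒≱ (2*gsum[1+n]<q^[1+n] e 2<q) (begin
    Q                     ≡⟨ Q≡p^K ⟩
    p ^ (suc m * suc e)   ≤⟨ p^k∣m*n⇒p^k≤m+n (suc m * suc e) p-prime p∤a+c 0<a 0<c (subst (_∣ a * c) Q≡p^K Q∣ac) ⟩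
    a + c                 ≤⟨ a+c≤2G ⟩
    2 * G                 ∎)
    where open ≤-Reasoning

  module _ (p≢2 : p ≢ 2) where

    p∤2G : p ∤ 2 * G
    p∤2G p∣2G with euclidsLemma 2 G p-prime p∣2G
    ... | inj₁ p∣2 = p≢2 (prime∣2⇒≡2 p-prime p∣2)
    ... | inj₂ p∣G = p∤G p∣G

    ¬factorisation-odd : ∀ {μ} → ¬ Factorisation q e μ
    ¬factorisation-odd {μ} F =
      Q∤a*c (subst (p ∤_) (sym w₁+w₂≡2G) p∤2G) w₁>0 w₂>0 (≤-reflexive w₁+w₂≡2G) (Q∣v*n⇒Q∣n p∤v Q∣vw₁w₂)
      where
      open Factorisation F
      p∤v : p ∤ v
      p∤v p∣v = p≢2 (prime∣2⇒≡2 p-prime (∣m+n∣m⇒∣n (subst (p ∣_) 2v≡qH[1+Q]+2 (∣n⇒∣m*n 2 p∣v))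
                                                  (∣m⇒∣m*n (suc Q) (∣m⇒∣m*n H p∣q))))
      Q∣vw₁w₂ : Q ∣ v * (w₁ * w₂)
      Q∣vw₁w₂ = divides (4 * (μ * G * H))
        (trans vw₁w₂≡4QμGH (trans (cong (4 *_) (*-comm Q (μ * G * H))) (sym (*-assoc 4 (μ * G * H) Q))))

    ¬square : 0 < H → ¬ ∃ λ (x : ℤ) → (+ G) ℤ.* (+ G) ℤ.- (+ Q) ℤ.* (+ H) ≡ x ℤ.* x
    ¬square 0<H (x , G²-QH≡x²)
      with difference-of-squares {G} {ℤ.∣ x ∣} {Q * H} (+m*+m-+k*+l≡x*x⇒m*m≡∣x∣*∣x∣+k*l {G} {Q} {H} {x} G²-QH≡x²)
    ... | a , a+y≡G , a[G+y]≡QH =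
      Q∤a*c (subst (p ∤_) (sym a+[G+y]≡2G) p∤2G) 0<a 0<G+y (≤-reflexive a+[G+y]≡2G)
            (divides H (trans a[G+y]≡QH (*-comm Q H)))
      where
      y = ℤ.∣ x ∣
      0<QH : 0 < Q * H
      0<QH = *-mono-≤ (m^n>0 q {{>-nonZero (<-trans z<s 2<q)}} (suc e)) 0<H
      0<a : 0 < a
      0<a = m*n>0⇒m>0 a (subst (0 <_) (sym a[G+y]≡QH) 0<QH)
      0<G+y : 0 < G + y
      0<G+y = m*n>0⇒m>0 (G + y) (subst (0 <_) (trans (sym a[G+y]≡QH) (*-comm a (G + y))) 0<QH)
      a+[G+y]≡2G : a + (G + y) ≡ 2 * G
      a+[G+y]≡2G = begin
        a + (G + y)   ≡⟨ cong (λ t → a + t) (+-comm G y) ⟩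
        a + (y + G)   ≡⟨ +-assoc a y G ⟨
        a + y + G     ≡⟨ cong (_+ G) a+y≡G ⟩
        G + G         ≡⟨ cong (λ t → G + t) (+-identityʳ G) ⟨
        2 * G         ∎
        where open ≡-Reasoning

  module _ (p≡2 : p ≡ 2) where

    4∣q : 4 ∣ q
    4∣q = subst (4 ∣_) (sym q≡2^[1+m]) (2<2^[1+m]⇒4∣2^[1+m] m (subst (2 <_) q≡2^[1+m] 2<q))
      where
      q≡2^[1+m] : q ≡ 2 ^ suc m
      q≡2^[1+m] = subst (λ t → q ≡ t ^ suc m) p≡2 q≡p^[1+m]

    ¬factorisation-even : ∀ {μ} → ¬ Factorisation q e μ
    ¬factorisation-even {μ} F@record { v = v } = halves (p∣m+n⇒p∣m*n⇒p∣m×p∣n prime[2] 2∣w₁+w₂ 2∣w₁w₂)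
      where
      open Factorisation F hiding (v)
      2∤v : 2 ∤ v
      2∤v 2∣v = >⇒∤ (s<s (s<s z<s)) (∣m+n∣m⇒∣n (subst (4 ∣_) 2v≡qH[1+Q]+2 (*-monoʳ-∣ 2 2∣v))
                                                (∣m⇒∣m*n (suc Q) (∣m⇒∣m*n H 4∣q)))
      2∣w₁+w₂ : 2 ∣ w₁ + w₂
      2∣w₁+w₂ = subst (2 ∣_) (sym w₁+w₂≡2G) (m∣m*n G)
      2∣w₁w₂ : 2 ∣ w₁ * w₂
      2∣w₁w₂ = p^k∣m*n⇒p^k∣n 1 prime[2] 2∤v (subst (2 ∣_) (sym vw₁w₂≡4QμGH) (∣m⇒∣m*n (Q * (μ * G * H)) (divides 2 refl)))
      halves : 2 ∣ w₁ × 2 ∣ w₂ → ⊥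
      halves (divides t₁ w₁≡t₁*2 , divides t₂ w₂≡t₂*2) =
        Q∤a*c (subst (p ∤_) (sym t₁+t₂≡G) p∤G) (m*n>0⇒m>0 t₁ (subst (0 <_) w₁≡t₁*2 w₁>0))
              (m*n>0⇒m>0 t₂ (subst (0 <_) w₂≡t₂*2 w₂>0)) (≤-trans (≤-reflexive t₁+t₂≡G) (m≤n*m G 2))
              (Q∣v*n⇒Q∣n (subst (_∤ v) (sym p≡2) 2∤v) (divides (μ * G * H) (trans vt₁t₂≡QμGH (*-comm Q _))))
        where
        open ≡-Reasoning
        t₁+t₂≡G : t₁ + t₂ ≡ G
        t₁+t₂≡G = *-cancelʳ-≡ _ _ 2 (begin
          (t₁ + t₂) * 2       ≡⟨ *-distribʳ-+ 2 t₁ t₂ ⟩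
          t₁ * 2 + t₂ * 2     ≡⟨ cong₂ _+_ w₁≡t₁*2 w₂≡t₂*2 ⟨
          w₁ + w₂             ≡⟨ w₁+w₂≡2G ⟩
          2 * G               ≡⟨ *-comm 2 G ⟩
          G * 2               ∎)
        vt₁t₂≡QμGH : v * (t₁ * t₂) ≡ Q * (μ * G * H)
        vt₁t₂≡QμGH = *-cancelˡ-≡ _ _ 4 (begin
          4 * (v * (t₁ * t₂))          ≡⟨ solve (v ∷ t₁ ∷ t₂ ∷ []) ⟩
          v * ((t₁ * 2) * (t₂ * 2))    ≡⟨ cong₂ (λ a b → v * (a * b)) w₁≡t₁*2 w₂≡t₂*2 ⟨
          v * (w₁ * w₂)                ≡⟨ vw₁w₂≡4QμGH ⟩
          4 * (Q * (μ * G * H))        ∎)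

    q[q^e∸1]%8≢6 : (q * (q ^ e ∸ 1)) % 8 ≢ 6
    q[q^e∸1]%8≢6 = 4∣m⇒m%8≢6 (∣m⇒∣m*n _ 4∣q)


  ¬factorisation : ∀ {μ} → ¬ Factorisation q e μ
  ¬factorisation with p ≟ 2
  ... | yes p≡2 = ¬factorisation-even p≡2
  ... | no  p≢2 = ¬factorisation-odd p≢2

  ¬conditions : ∀ {μ} → 0 < H →
    ¬ ((q * (q ^ e ∸ 1)) % 8 ≡ 6 × 8 * μ ≡ (Q ∸ q) + 2 × ∃ λ (x : ℤ) → (+ G) ℤ.* (+ G) ℤ.- (+ Q) ℤ.* (+ H) ≡ x ℤ.* x)
  ¬conditions 0<H (q[q^e∸1]%8≡6 , _ , square) with p ≟ 2
  ... | yes p≡2 = q[q^e∸1]%8≢6 p≡2 q[q^e∸1]%8≡6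
  ... | no  p≢2 = ¬square p≢2 0<H square

corollary2p6 : (q d μ : ℕ) → IsPrimePower q → 2 < q → 2 ≤ d → 1 ≤ μ →
    FeasibleSp d q μ ⇔
      ((q * (q ^ (d ∸ 1) ∸ 1)) % 8 ≡ 6
       × 8 * μ ≡ (q ^ d ∸ q) + 2
       × ∃ λ (x : ℤ) →
           (+ gsum q d) ℤ.* (+ gsum q d) ℤ.- (+ (q ^ d)) ℤ.* (+ gsum q (d ∸ 1))
             ≡ x ℤ.* x)
corollary2p6 q (suc (suc e)) μ (p , m , p-prime , q≡p^[1+m]) 2<q (s≤s (s≤s _)) 0<μ = mk⇔
  (⊥-elim ∘ ¬factorisation {p} {m} {q} {suc e} p-prime q≡p^[1+m] 2<q
          ∘ feasibleSp⇒factorisation {q} {suc e} {μ} (<-trans z<s 2<q) 0<μ)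
  (⊥-elim ∘ ¬conditions {p} {m} {q} {suc e} p-prime q≡p^[1+m] 2<q {μ} (subst (0 <_) (sym (gsum-suc q e)) z<s))
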